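{- Let $n\ge 1$ and $k\ge 1$ be integers with $k<\lfloor n/3\rfloor$, let $N_{n,k,i}$ denote the number of binary sequences of length $n$ with exactly $i$ successes in which every run of consecutive failures has length strictly less than $k$, and let $i_{n,k}=\left\lfloor\frac{n-k+1}{k}\right\rfloor$. Then for every integer $i\in\{i_{n,k}+1,\dots,n-3k\}$, \[ \binom{n}{i}-(i+1)\binom{n-k}{i}\ \le\ N_{n,k,i}\ \le\ \binom{n}{i}-(i+1)\binom{n-k}{i}+\binom{i+1}{2}\binom{n-2k}{i}. \]
   Context: $N_{n,k,i}$ are the coefficients of the reliability polynomial $R(k,n;p)=\sum_{i}N_{n,k,i}p^i(1-p)^{n-i}$ of a consecutive-$k$-out-of-$n$:$F$ system (a sequence of $n$ i.i.d. Bernoulli trials that fails iff it contains at least $k$ consecutive failures). -}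

module Defs where

open import Data.Nat using (ℕ; zero; suc; _+_; _<_; _≤?_; _<?_)
open import Data.Bool using (Bool; true; false; _∧_)
open import Data.List using (List; []; _∷_; length; filter; map; _++_; concatMap)
open import Data.Nat.Properties using (_≟_)
open import Relation.Nullary.Decidable using (⌊_⌋)

-- All binary sequences of length n (true = success, false = failure).
allSeqs : ℕ → List (List Bool)
allSeqs zero = [] ∷ []
allSeqs (suc n) = map (true ∷_) (allSeqs n) ++ map (false ∷_) (allSeqs n)

successes : List Bool → ℕ
successes [] = 0
successes (true ∷ xs) = suc (successes xs)
successes (false ∷ xs) = successes xs

maxRunAux : ℕ → List Bool → ℕ
maxRunAux cur [] = cur
maxRunAux cur (true ∷ xs) = Data.Nat._⊔_ cur (maxRunAux 0 xs)
maxRunAux cur (false ∷ xs) = maxRunAux (suc cur) xs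

maxFailRun : List Bool → ℕ
maxFailRun = maxRunAux 0

good : ℕ → ℕ → List Bool → Bool
good k i xs = ⌊ maxFailRun xs <? k ⌋ ∧ ⌊ successes xs ≟ i ⌋

N : ℕ → ℕ → ℕ → ℕ
N n k i = length (filter (λ xs → Data.Bool._≟_ (good k i xs) true) (allSeqs n))

-- For a sequence xs let m(xs) be the number of its maximal failure runs of length at
-- least k.  The indicator that xs has no such run satisfies the Bonferroni bounds
-- 1 − m ≤ [m ≡ 0] ≤ 1 − m + m C 2.  Summed over the sequences with i successes they
-- give the theorem, because the binomial moments of m are explicit: a sequence with
-- i successes has i + 1 gaps, and deleting k failures from one marked long gap
-- (2k from two) is a bijection onto sequences of length n − k (n − 2k), so
-- Σ m = (i + 1) C(n − k, i) and Σ (m C 2) = (i + 1) C 2 · C(n − 2k, i).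
module Submission where

open import Defs
open import Data.Nat using (ℕ; _+_; _*_; _∸_; _≤_; _<_; _/_; NonZero)
open import Data.Nat.Combinatorics using (_C_)
open import Data.Product using (_×_)

open import Algebra.Properties.CommutativeSemigroup using (interchange)
open import Data.Bool using (Bool; true; false; _∧_; if_then_else_)
import Data.Bool as Bool
open import Data.Empty using (⊥-elim)
open import Data.List using (List; []; _∷_; length; filter; map; _++_)
open import Data.List.Properties using (map-++; map-∘)
open import Data.Nat using (zero; suc; pred; z≤n; s≤s; s≤s⁻¹; _≟_; _<?_)
open import Data.Nat.Combinatorics using (nC1≡n; nCk+nC[k+1]≡[n+1]C[k+1])
open import Data.Nat.ListAction using (sum)
open import Data.Nat.ListAction.Properties using (sum-++)
open import Data.Nat.Properties
open import Data.Nat.Tactic.RingSolver using (solve-∀)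
open import Data.Product using (_,_)
open import Function using (_∘_; _⇔_; mk⇔; Equivalence)
open import Relation.Binary.PropositionalEquality
open import Relation.Nullary.Decidable using (Dec; ⌊_⌋; isYes≗does; does-⇔)

𝟙 : Bool → ℕ
𝟙 true = 1
𝟙 false = 0

[_≡0] : ℕ → ℕ
[ m ≡0] = 𝟙 ⌊ m ≟ 0 ⌋

sumOver : ℕ → ℕ → (List Bool → ℕ) → ℕ
sumOver zero zero f = f []
sumOver zero (suc i) f = 0
sumOver (suc n) zero f = sumOver n zero (f ∘ (false ∷_))
sumOver (suc n) (suc i) f = sumOver n i (f ∘ (true ∷_)) + sumOver n (suc i) (f ∘ (false ∷_))

sumOver-cong : ∀ n i {f g : List Bool → ℕ} → (∀ xs → f xs ≡ g xs) → sumOver n i f ≡ sumOver n i g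
sumOver-cong zero zero f≗g = f≗g []
sumOver-cong zero (suc i) f≗g = refl
sumOver-cong (suc n) zero f≗g = sumOver-cong n zero (f≗g ∘ (false ∷_))
sumOver-cong (suc n) (suc i) f≗g =
  cong₂ _+_ (sumOver-cong n i (f≗g ∘ (true ∷_))) (sumOver-cong n (suc i) (f≗g ∘ (false ∷_)))

sumOver-mono : ∀ n i {f g : List Bool → ℕ} → (∀ xs → f xs ≤ g xs) → sumOver n i f ≤ sumOver n i g
sumOver-mono zero zero f≤g = f≤g []
sumOver-mono zero (suc i) f≤g = z≤n
sumOver-mono (suc n) zero f≤g = sumOver-mono n zero (f≤g ∘ (false ∷_))
sumOver-mono (suc n) (suc i) f≤g =
  +-mono-≤ (sumOver-mono n i (f≤g ∘ (true ∷_))) (sumOver-mono n (suc i) (f≤g ∘ (false ∷_)))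

sumOver-+ : ∀ n i (f g : List Bool → ℕ) →
            sumOver n i (λ xs → f xs + g xs) ≡ sumOver n i f + sumOver n i g
sumOver-+ zero zero f g = refl
sumOver-+ zero (suc i) f g = refl
sumOver-+ (suc n) zero f g = sumOver-+ n zero (f ∘ (false ∷_)) (g ∘ (false ∷_))
sumOver-+ (suc n) (suc i) f g =
  trans (cong₂ _+_ (sumOver-+ n i (f ∘ (true ∷_)) (g ∘ (true ∷_)))
                   (sumOver-+ n (suc i) (f ∘ (false ∷_)) (g ∘ (false ∷_))))
        (interchange +-commutativeSemigroup (sumOver n i (f ∘ (true ∷_))) (sumOver n i (g ∘ (true ∷_)))
                     (sumOver n (suc i) (f ∘ (false ∷_))) (sumOver n (suc i) (g ∘ (false ∷_))))

sumOver-*ˡ : ∀ n i c (f : List Bool → ℕ) → sumOver n i (λ xs → c * f xs) ≡ c * sumOver n i f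
sumOver-*ˡ zero zero c f = refl
sumOver-*ˡ zero (suc i) c f = sym (*-zeroʳ c)
sumOver-*ˡ (suc n) zero c f = sumOver-*ˡ n zero c (f ∘ (false ∷_))
sumOver-*ˡ (suc n) (suc i) c f =
  trans (cong₂ _+_ (sumOver-*ˡ n i c _) (sumOver-*ˡ n (suc i) c _)) (sym (*-distribˡ-+ c _ _))

sumOver-const : ∀ n i c → sumOver n i (λ _ → c) ≡ c * (n C i)
sumOver-const zero zero c = sym (*-identityʳ c)
sumOver-const zero (suc i) c = sym (*-zeroʳ c)
sumOver-const (suc n) zero c = sumOver-const n zero c
sumOver-const (suc n) (suc i) c = begin
  sumOver n i (λ _ → c) + sumOver n (suc i) (λ _ → c) ≡⟨ cong₂ _+_ (sumOver-const n i c) (sumOver-const n (suc i) c) ⟩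
  c * (n C i) + c * (n C suc i)                       ≡⟨ *-distribˡ-+ c (n C i) (n C suc i) ⟨
  c * (n C i + n C suc i)                             ≡⟨ cong (c *_) (nCk+nC[k+1]≡[n+1]C[k+1] n i) ⟩
  c * (suc n C suc i)                                 ∎
  where open ≡-Reasoning

sum-map-zero : ∀ {A : Set} (g : A → ℕ) xs → (∀ x → g x ≡ 0) → sum (map g xs) ≡ 0
sum-map-zero g [] g≗0 = refl
sum-map-zero g (x ∷ xs) g≗0 = cong₂ _+_ (g≗0 x) (sum-map-zero g xs g≗0)

sum-map-allSeqs-suc : ∀ n (g : List Bool → ℕ) →
  sum (map g (allSeqs (suc n))) ≡ sum (map (g ∘ (true ∷_)) (allSeqs n)) + sum (map (g ∘ (false ∷_)) (allSeqs n))
sum-map-allSeqs-suc n g = begin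
  sum (map g (map (true ∷_) xss ++ map (false ∷_) xss))
    ≡⟨ cong sum (map-++ g (map (true ∷_) xss) (map (false ∷_) xss)) ⟩
  sum (map g (map (true ∷_) xss) ++ map g (map (false ∷_) xss))
    ≡⟨ sum-++ (map g (map (true ∷_) xss)) (map g (map (false ∷_) xss)) ⟩
  sum (map g (map (true ∷_) xss)) + sum (map g (map (false ∷_) xss))
    ≡⟨ cong₂ _+_ (cong sum (map-∘ xss)) (cong sum (map-∘ xss)) ⟨
  sum (map (g ∘ (true ∷_)) xss) + sum (map (g ∘ (false ∷_)) xss) ∎
  where open ≡-Reasoning
        xss = allSeqs n

⌊⌋-⇔ : ∀ {A B : Set} → A ⇔ B → (a? : Dec A) (b? : Dec B) → ⌊ a? ⌋ ≡ ⌊ b? ⌋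
⌊⌋-⇔ A⇔B a? b? = trans (isYes≗does a?) (trans (does-⇔ A⇔B a? b?) (sym (isYes≗does b?)))

≟-suc : ∀ a b → ⌊ suc a ≟ suc b ⌋ ≡ ⌊ a ≟ b ⌋
≟-suc a b = ⌊⌋-⇔ (mk⇔ suc-injective (cong suc)) (suc a ≟ suc b) (a ≟ b)

sum-allSeqs : ∀ n i (f g : List Bool → ℕ) → (∀ xs → g xs ≡ (if ⌊ successes xs ≟ i ⌋ then f xs else 0)) →
              sum (map g (allSeqs n)) ≡ sumOver n i f
sum-allSeqs zero zero f g g≗ = trans (+-identityʳ (g [])) (g≗ [])
sum-allSeqs zero (suc i) f g g≗ = trans (+-identityʳ (g [])) (g≗ [])
sum-allSeqs (suc n) zero f g g≗ =
  trans (sum-map-allSeqs-suc n g)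
        (cong₂ _+_ (sum-map-zero _ (allSeqs n) (g≗ ∘ (true ∷_)))
                   (sum-allSeqs n zero (f ∘ (false ∷_)) (g ∘ (false ∷_)) (g≗ ∘ (false ∷_))))
sum-allSeqs (suc n) (suc i) f g g≗ =
  trans (sum-map-allSeqs-suc n g)
        (cong₂ _+_ (sum-allSeqs n i (f ∘ (true ∷_)) (g ∘ (true ∷_)) true-case)
                   (sum-allSeqs n (suc i) (f ∘ (false ∷_)) (g ∘ (false ∷_)) (g≗ ∘ (false ∷_))))
  where
  true-case : ∀ xs → g (true ∷ xs) ≡ (if ⌊ successes xs ≟ i ⌋ then f (true ∷ xs) else 0)
  true-case xs = trans (g≗ (true ∷ xs)) (cong (λ b → if b then f (true ∷ xs) else 0) (≟-suc (successes xs) i))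

length-filter-≡true : ∀ {A : Set} (q : A → Bool) xs →
                      length (filter (λ x → q x Bool.≟ true) xs) ≡ sum (map (𝟙 ∘ q) xs)
length-filter-≡true q [] = refl
length-filter-≡true q (x ∷ xs) with q x
... | true = cong suc (length-filter-≡true q xs)
... | false = length-filter-≡true q xs

𝟙-∧ : ∀ a b → 𝟙 (a ∧ b) ≡ (if b then 𝟙 a else 0)
𝟙-∧ true true = refl
𝟙-∧ true false = refl
𝟙-∧ false true = refl
𝟙-∧ false false = refl

N≡sumOver : ∀ n k i → N n k i ≡ sumOver n i (λ xs → 𝟙 ⌊ maxFailRun xs <? k ⌋)
N≡sumOver n k i =
  trans (length-filter-≡true (good k i) (allSeqs n))
        (sum-allSeqs n i _ (𝟙 ∘ good k i) (λ xs → 𝟙-∧ ⌊ maxFailRun xs <? k ⌋ ⌊ successes xs ≟ i ⌋))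

-- longRunsAfter k d xs counts the maximal failure runs of xs of length at least k,
-- where the first run already counts once d more failures have been read.
longRunsAfter : ℕ → ℕ → List Bool → ℕ
longRunsAfter k d [] = [ d ≡0]
longRunsAfter k d (true ∷ xs) = [ d ≡0] + longRunsAfter k k xs
longRunsAfter k d (false ∷ xs) = longRunsAfter k (pred d) xs

longRuns : ℕ → List Bool → ℕ
longRuns k = longRunsAfter k k

<⇔[∸≡0]≡0 : ∀ c k → c < k ⇔ [ k ∸ c ≡0] ≡ 0
<⇔[∸≡0]≡0 zero zero = mk⇔ (λ ()) (λ ())
<⇔[∸≡0]≡0 (suc c) zero = mk⇔ (λ ()) (λ ())
<⇔[∸≡0]≡0 zero (suc k) = mk⇔ (λ _ → refl) (λ _ → s≤s z≤n)
<⇔[∸≡0]≡0 (suc c) (suc k) = mk⇔ (to ∘ s≤s⁻¹) (s≤s ∘ from)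
  where open Equivalence (<⇔[∸≡0]≡0 c k)

maxRunAux<⇔longRunsAfter≡0 : ∀ k c xs → maxRunAux c xs < k ⇔ longRunsAfter k (k ∸ c) xs ≡ 0
maxRunAux<⇔longRunsAfter≡0 k c [] = <⇔[∸≡0]≡0 c k
maxRunAux<⇔longRunsAfter≡0 k c (true ∷ xs) = mk⇔
  (λ lt → cong₂ _+_ (head.to (m⊔n<o⇒m<o c _ lt)) (tail.to (m⊔n<o⇒n<o c _ lt)))
  (λ eq → ⊔-lub (head.from (m+n≡0⇒m≡0 _ eq)) (tail.from (m+n≡0⇒n≡0 [ k ∸ c ≡0] eq)))
  where module head = Equivalence (<⇔[∸≡0]≡0 c k)
        module tail = Equivalence (maxRunAux<⇔longRunsAfter≡0 k 0 xs)
maxRunAux<⇔longRunsAfter≡0 k c (false ∷ xs) rewrite pred[m∸n]≡m∸[1+n] k c =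
  maxRunAux<⇔longRunsAfter≡0 k (suc c) xs

noLongRun≡[longRuns≡0] : ∀ k xs → 𝟙 ⌊ maxFailRun xs <? k ⌋ ≡ [ longRuns k xs ≡0]
noLongRun≡[longRuns≡0] k xs =
  cong 𝟙 (⌊⌋-⇔ (maxRunAux<⇔longRunsAfter≡0 k 0 xs) (maxFailRun xs <? k) (longRuns k xs ≟ 0))

sucC2 : ∀ m → suc m C 2 ≡ m + m C 2
sucC2 m = trans (sym (nCk+nC[k+1]≡[n+1]C[k+1] m 1)) (cong (_+ m C 2) (nC1≡n m))

bonferroni-lower : ∀ m → 1 ≤ [ m ≡0] + m
bonferroni-lower zero = s≤s z≤n
bonferroni-lower (suc m) = s≤s z≤n

bonferroni-upper : ∀ m → [ m ≡0] + m ≤ 1 + m C 2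
bonferroni-upper zero = ≤-refl
bonferroni-upper (suc m) = s≤s (subst (m ≤_) (sym (sucC2 m)) (m≤m+n m (m C 2)))

-- shiftedC n d i = (n ∸ d) C i if d ≤ n and 0 otherwise: the number of sequences of
-- length n with i successes that begin with at least d failures.
shiftedC : ℕ → ℕ → ℕ → ℕ
shiftedC n zero i = n C i
shiftedC zero (suc d) i = 0
shiftedC (suc n) (suc d) i = shiftedC n d i

shiftedC≡C : ∀ n d i → shiftedC n d (suc i) ≡ (n ∸ d) C suc i
shiftedC≡C n zero i = refl
shiftedC≡C zero (suc d) i = refl
shiftedC≡C (suc n) (suc d) i = shiftedC≡C n d i

shiftedC-zero : ∀ d i → shiftedC zero d (suc i) ≡ 0
shiftedC-zero zero i = refl
shiftedC-zero (suc d) i = refl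

shiftedC-pascal : ∀ n d i → shiftedC (suc n) d (suc i) ≡ shiftedC n d i + shiftedC n d (suc i)
shiftedC-pascal n zero i = sym (nCk+nC[k+1]≡[n+1]C[k+1] n i)
shiftedC-pascal zero (suc d) i = shiftedC-zero d i
shiftedC-pascal (suc n) (suc d) i = shiftedC-pascal n d i

shiftedC-suc : ∀ n d i → shiftedC (suc n) d (suc i) ≡ [ d ≡0] * (n C i) + shiftedC n (pred d) (suc i)
shiftedC-suc n zero i = trans (sym (nCk+nC[k+1]≡[n+1]C[k+1] n i)) (cong (_+ n C suc i) (sym (+-identityʳ (n C i))))
shiftedC-suc n (suc d) i = refl

shiftedC-suc-+ : ∀ n d e i →
                 shiftedC (suc n) (d + e) (suc i) ≡ [ d ≡0] * shiftedC n e i + shiftedC n (pred d + e) (suc i)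
shiftedC-suc-+ n zero e i = trans (shiftedC-pascal n e i) (cong (_+ shiftedC n e (suc i)) (sym (+-identityʳ _)))
shiftedC-suc-+ n (suc d) e i = refl

sumOver-longRunsAfter : ∀ k n d i → sumOver n i (longRunsAfter k d) ≡ shiftedC n d i + i * shiftedC n k i
sumOver-longRunsAfter k zero zero zero = refl
sumOver-longRunsAfter k zero (suc d) zero = refl
sumOver-longRunsAfter k zero d (suc i) =
  sym (trans (cong₂ _+_ (shiftedC-zero d i) (cong (suc i *_) (shiftedC-zero k i))) (*-zeroʳ (suc i)))
sumOver-longRunsAfter k (suc n) zero zero = sumOver-longRunsAfter k n zero zero
sumOver-longRunsAfter k (suc n) (suc d) zero = sumOver-longRunsAfter k n d zero
sumOver-longRunsAfter k (suc n) d (suc i) = begin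
  sumOver n i (λ xs → [ d ≡0] + longRuns k xs) + R
    ≡⟨ cong (_+ R) (sumOver-+ n i (λ _ → [ d ≡0]) (longRuns k)) ⟩
  (sumOver n i (λ _ → [ d ≡0]) + sumOver n i (longRuns k)) + R
    ≡⟨ cong₂ _+_ (cong₂ _+_ (sumOver-const n i [ d ≡0]) (sumOver-longRunsAfter k n k i))
                 (sumOver-longRunsAfter k n (pred d) (suc i)) ⟩
  ([ d ≡0] * (n C i) + (x + i * x)) + (y + suc i * z)
    ≡⟨ regroup ([ d ≡0] * (n C i)) x i y z ⟩
  ([ d ≡0] * (n C i) + y) + suc i * (x + z)
    ≡⟨ cong₂ (λ a b → a + suc i * b) (shiftedC-suc n d i) (shiftedC-pascal n k i) ⟨
  shiftedC (suc n) d (suc i) + suc i * shiftedC (suc n) k (suc i) ∎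
  where
  open ≡-Reasoning
  R = sumOver n (suc i) (longRunsAfter k (pred d))
  x = shiftedC n k i
  y = shiftedC n (pred d) (suc i)
  z = shiftedC n k (suc i)
  regroup : ∀ a x i y z → (a + (x + i * x)) + (y + suc i * z) ≡ (a + y) + suc i * (x + z)
  regroup = solve-∀

C2-[≡0]+ : ∀ d m → ([ d ≡0] + m) C 2 ≡ [ d ≡0] * m + m C 2
C2-[≡0]+ zero m = trans (sucC2 m) (cong (_+ m C 2) (sym (+-identityʳ m)))
C2-[≡0]+ (suc d) m = refl

sumOver-longRunsAfter-C2 : ∀ k n d i →
  sumOver n i (λ xs → longRunsAfter k d xs C 2) ≡ i * shiftedC n (d + k) i + (i C 2) * shiftedC n (k + k) i
sumOver-longRunsAfter-C2 k zero zero zero = refl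
sumOver-longRunsAfter-C2 k zero (suc d) zero = refl
sumOver-longRunsAfter-C2 k zero d (suc i) =
  sym (trans (cong₂ _+_ (cong (suc i *_) (shiftedC-zero (d + k) i)) (cong ((suc i C 2) *_) (shiftedC-zero (k + k) i)))
             (cong₂ _+_ (*-zeroʳ (suc i)) (*-zeroʳ (suc i C 2))))
sumOver-longRunsAfter-C2 k (suc n) d zero = sumOver-longRunsAfter-C2 k n (pred d) zero
sumOver-longRunsAfter-C2 k (suc n) d (suc i) = begin
  sumOver n i (λ xs → ([ d ≡0] + longRuns k xs) C 2) + R
    ≡⟨ cong (_+ R) (sumOver-cong n i (λ xs → C2-[≡0]+ d (longRuns k xs))) ⟩
  sumOver n i (λ xs → [ d ≡0] * longRuns k xs + longRuns k xs C 2) + R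
    ≡⟨ cong (_+ R) (trans (sumOver-+ n i _ _) (cong (_+ _) (sumOver-*ˡ n i [ d ≡0] (longRuns k)))) ⟩
  ([ d ≡0] * sumOver n i (longRuns k) + sumOver n i (λ xs → longRuns k xs C 2)) + R
    ≡⟨ cong₂ _+_ (cong₂ (λ a b → [ d ≡0] * a + b) (sumOver-longRunsAfter k n k i) (sumOver-longRunsAfter-C2 k n k i))
                 (sumOver-longRunsAfter-C2 k n (pred d) (suc i)) ⟩
  ([ d ≡0] * (x + i * x) + (i * w + (i C 2) * w)) + (suc i * y + (suc i C 2) * z)
    ≡⟨ cong (λ c → ([ d ≡0] * (x + i * x) + (i * w + (i C 2) * w)) + (suc i * y + c * z)) (sucC2 i) ⟩
  ([ d ≡0] * (x + i * x) + (i * w + (i C 2) * w)) + (suc i * y + (i + i C 2) * z)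
    ≡⟨ regroup [ d ≡0] x i w y z (i C 2) ⟩
  suc i * ([ d ≡0] * x + y) + (i + i C 2) * (w + z)
    ≡⟨ cong₂ (λ a b → suc i * a + (i + i C 2) * b) (shiftedC-suc-+ n d k i) (shiftedC-pascal n (k + k) i) ⟨
  suc i * shiftedC (suc n) (d + k) (suc i) + (i + i C 2) * shiftedC (suc n) (k + k) (suc i)
    ≡⟨ cong (λ c → suc i * shiftedC (suc n) (d + k) (suc i) + c * shiftedC (suc n) (k + k) (suc i)) (sucC2 i) ⟨
  suc i * shiftedC (suc n) (d + k) (suc i) + (suc i C 2) * shiftedC (suc n) (k + k) (suc i) ∎
  where
  open ≡-Reasoning
  R = sumOver n (suc i) (λ xs → longRunsAfter k (pred d) xs C 2)
  x = shiftedC n k i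
  w = shiftedC n (k + k) i
  y = shiftedC n (pred d + k) (suc i)
  z = shiftedC n (k + k) (suc i)
  regroup : ∀ a x i w y z c → (a * (x + i * x) + (i * w + c * w)) + (suc i * y + (i + c) * z)
                              ≡ suc i * (a * x + y) + (i + c) * (w + z)
  regroup = solve-∀

sumOver-longRuns : ∀ k n j → sumOver n (suc j) (longRuns k) ≡ (suc j + 1) * ((n ∸ k) C suc j)
sumOver-longRuns k n j = begin
  sumOver n (suc j) (longRuns k)                         ≡⟨ sumOver-longRunsAfter k n k (suc j) ⟩
  shiftedC n k (suc j) + suc j * shiftedC n k (suc j)    ≡⟨ x+ix≡[i+1]x (shiftedC n k (suc j)) (suc j) ⟩
  (suc j + 1) * shiftedC n k (suc j)                     ≡⟨ cong ((suc j + 1) *_) (shiftedC≡C n k j) ⟩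
  (suc j + 1) * ((n ∸ k) C suc j)                        ∎
  where
  open ≡-Reasoning
  x+ix≡[i+1]x : ∀ x i → x + i * x ≡ (i + 1) * x
  x+ix≡[i+1]x = solve-∀

sumOver-longRuns-C2 : ∀ k n j →
  sumOver n (suc j) (λ xs → longRuns k xs C 2) ≡ ((suc j + 1) C 2) * ((n ∸ 2 * k) C suc j)
sumOver-longRuns-C2 k n j = begin
  sumOver n i (λ xs → longRuns k xs C 2) ≡⟨ sumOver-longRunsAfter-C2 k n k i ⟩
  i * w + (i C 2) * w                    ≡⟨ *-distribʳ-+ w i (i C 2) ⟨
  (i + i C 2) * w                        ≡⟨ cong₂ _*_ (trans (sym (sucC2 i)) (cong (_C 2) (+-comm 1 i))) (shiftedC≡C n (k + k) j) ⟩
  ((i + 1) C 2) * ((n ∸ (k + k)) C i)    ≡⟨ cong (λ m → ((i + 1) C 2) * ((n ∸ (k + m)) C i)) (+-identityʳ k) ⟨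
  ((i + 1) C 2) * ((n ∸ 2 * k) C i)      ∎
  where
  open ≡-Reasoning
  i = suc j
  w = shiftedC n (k + k) i

proposition3 : (n k i : ℕ) → 1 ≤ n → 1 ≤ k → .{{_ : NonZero k}} → k < n / 3 →
    ((n ∸ k + 1) / k) + 1 ≤ i → i ≤ n ∸ 3 * k →
    (n C i ≤ N n k i + (i + 1) * ((n ∸ k) C i)) ×
    (N n k i + (i + 1) * ((n ∸ k) C i) ≤ n C i + ((i + 1) C 2) * ((n ∸ 2 * k) C i))
proposition3 n k zero _ _ _ i₀+1≤i _ = ⊥-elim (n≮0 (≤-trans (m≤n+m 1 _) i₀+1≤i))
proposition3 n k i@(suc j) _ _ _ _ _ = lower , upper
  where
  open ≤-Reasoning
  m : List Bool → ℕ
  m = longRuns k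
  weight : List Bool → ℕ
  weight xs = 𝟙 ⌊ maxFailRun xs <? k ⌋ + m xs
  weight≡ : ∀ xs → weight xs ≡ [ m xs ≡0] + m xs
  weight≡ xs = cong (_+ m xs) (noLongRun≡[longRuns≡0] k xs)
  total : sumOver n i weight ≡ N n k i + (i + 1) * ((n ∸ k) C i)
  total = trans (sumOver-+ n i _ m) (cong₂ _+_ (sym (N≡sumOver n k i)) (sumOver-longRuns k n j))
  count : sumOver n i (λ _ → 1) ≡ n C i
  count = trans (sumOver-const n i 1) (*-identityˡ (n C i))
  lower = begin
    n C i                              ≡⟨ count ⟨
    sumOver n i (λ _ → 1)              ≤⟨ sumOver-mono n i (λ xs → subst (1 ≤_) (sym (weight≡ xs)) (bonferroni-lower (m xs))) ⟩
    sumOver n i weight                 ≡⟨ total ⟩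
    N n k i + (i + 1) * ((n ∸ k) C i)  ∎
  upper = begin
    N n k i + (i + 1) * ((n ∸ k) C i)                 ≡⟨ total ⟨
    sumOver n i weight                                ≤⟨ sumOver-mono n i (λ xs → subst (_≤ 1 + m xs C 2) (sym (weight≡ xs)) (bonferroni-upper (m xs))) ⟩
    sumOver n i (λ xs → 1 + m xs C 2)                 ≡⟨ sumOver-+ n i (λ _ → 1) (λ xs → m xs C 2) ⟩
    sumOver n i (λ _ → 1) + sumOver n i (λ xs → m xs C 2) ≡⟨ cong₂ _+_ count (sumOver-longRuns-C2 k n j) ⟩
    n C i + ((i + 1) C 2) * ((n ∸ 2 * k) C i)         ∎
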